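{- Let $k\ge 2$, $n\ge k+1$, $1\le j\le n-k$, and let $\pi$ be a permutation of $[n]$. If the windows $(\pi(j),\dots,\pi(j+k-1))$ and $(\pi(j+1),\dots,\pi(j+k))$ (which overlap in $k-1$ positions) are both order isomorphic to the same permutation $\mu$ of $[k]$, then $\mu$ is monotone, i.e., $\mu=(1,2,\dots,k)$ or $\mu=(k,k-1,\dots,1)$. Equivalently, the only $k$-permutations that are $(k-1)$-good are the monotone ones.
   Context: Two sequences of distinct numbers of the same length $k$ are order isomorphic if for all $i,j\in[k]$, the $i$th entry is smaller than the $j$th entry in one sequence iff the same holds in the other; a sequence is order isomorphic to a permutation $\mu$ of $[k]$ if it is in the same relative order as $(\mu_1,\dots,\mu_k)$. A $k$-permutation $\mu$ is called $l$-good if it is possible for two windows of $k$ consecutive positions of a random permutation, overlapping in exactly $l$ positions, to both be order isomorphic to $\mu$. -}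

module Defs where

open import Data.Nat using (ℕ; suc; _+_; _<_; _≤_)
open import Data.Fin using (Fin; toℕ; fromℕ<; opposite)
import Data.Fin as F
open import Data.Fin.Permutation using (Permutation′; _⟨$⟩ʳ_)
open import Data.Product using (_×_)
open import Function.Bundles using (_⇔_)

-- Sequences of length k are modelled as functions Fin k → Fin n (positions
-- 0-indexed).
OrderIso : ∀ {k m m'} → (Fin k → Fin m) → (Fin k → Fin m') → Set
OrderIso {k} s t = (a b : Fin k) → (s a F.< s b) ⇔ (t a F.< t b)

window : ∀ {n} (π : Permutation′ n) (k j : ℕ) → j + k ≤ n → Fin k → Fin n
window {n} π k j jk i = π ⟨$⟩ʳ fromℕ< (lt i)
  where
  open import Data.Nat.Properties using (+-monoʳ-<; <-≤-trans)
  lt : (i : Fin k) → j + toℕ i < n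
  lt i = <-≤-trans (+-monoʳ-< j (Data.Fin.Properties.toℕ<n i)) jk
    where import Data.Fin.Properties

Increasing : ∀ {k} → Permutation′ k → Set
Increasing {k} μ = (i : Fin k) → μ ⟨$⟩ʳ i Relation.Binary.PropositionalEquality.≡ i
  where import Relation.Binary.PropositionalEquality

Decreasing : ∀ {k} → Permutation′ k → Set
Decreasing {k} μ = (i : Fin k) → μ ⟨$⟩ʳ i Relation.Binary.PropositionalEquality.≡ opposite i
  where import Relation.Binary.PropositionalEquality

prevBound : ∀ {j k n} → suc j + k ≤ n → j + k ≤ n
prevBound {j} {k} h = Data.Nat.Properties.≤-trans (Data.Nat.Properties.n≤1+n (j + k)) h
  where import Data.Nat.Properties

-- Read through the window starting at j+1, the i-th adjacent pair of μ is
-- the pair of entries of π at positions j+1+i and j+2+i; read through the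
-- window starting at j, that same pair of π is the (i+1)-st adjacent pair of
-- μ. So μ has an ascent at i iff it has one at i+1, hence μ ascends at every
-- step or descends at every step, and the only such permutations of [k] are
-- the identity and the reversal.
module Submission where

open import Defs
open import Data.Nat using (ℕ; suc; _+_; _≤_)
open import Data.Fin using (Fin)
open import Data.Fin.Permutation using (Permutation′; _⟨$⟩ʳ_)
open import Data.Sum using (_⊎_)

open import Data.Nat using (z≤n; s≤s; s≤s⁻¹)
import Data.Nat.Properties as ℕ
open import Data.Fin using (zero; suc; toℕ; inject₁; opposite; _<_)
import Data.Fin as F
open import Data.Fin.Properties
  using (toℕ-injective; toℕ-fromℕ; toℕ-fromℕ<; toℕ-inject₁; 0≢1+n; toℕ<n; <-cmp; ≤-antisym;
         opposite-prop; opposite-involutive)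
open import Data.Fin.Induction using (<-weakInduction; >-weakInduction)
open import Data.Sum using (inj₁; inj₂)
open import Data.Empty using (⊥-elim)
open import Function using (_∘_; id)
open import Function.Bundles using (Equivalence; Injection; _⇔_)
open import Function.Properties.Inverse using (↔⇒↣)
open import Function.Definitions using (Injective)
import Function.Properties.Equivalence as ⇔
open import Relation.Binary.Definitions using (tri<; tri≈; tri>)
open import Relation.Binary.PropositionalEquality
  using (_≡_; _≗_; sym; trans; cong; subst; subst₂; module ≡-Reasoning)

private
  variable
    k l m n n′ : ℕ

OrderIso-sym : {s : Fin k → Fin n} {t : Fin k → Fin n′} → OrderIso s t → OrderIso t s
OrderIso-sym iso a b = ⇔.sym (iso a b)

OrderIso-trans : {s : Fin k → Fin n} {t : Fin k → Fin n′} {u : Fin k → Fin m} →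
                 OrderIso s t → OrderIso t u → OrderIso s u
OrderIso-trans st tu a b = ⇔.trans (st a b) (tu a b)

OrderIso-∘ : {s : Fin k → Fin n} {t : Fin k → Fin n′} →
             OrderIso s t → (h : Fin l → Fin k) → OrderIso (s ∘ h) (t ∘ h)
OrderIso-∘ iso h a b = iso (h a) (h b)

≗⇒OrderIso : {s t : Fin k → Fin n} → s ≗ t → OrderIso s t
≗⇒OrderIso {s = s} s≗t a b = subst₂ (λ x y → (s a < s b) ⇔ (x < y)) (s≗t a) (s≗t b) ⇔.refl

window-≡ : ∀ (π : Permutation′ n) {k k′ j j′} {p : j + k ≤ n} {p′ : j′ + k′ ≤ n}
           (a : Fin k) (b : Fin k′) → j + toℕ a ≡ j′ + toℕ b →
           window π k j p a ≡ window π k′ j′ p′ b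
window-≡ π a b e =
  cong (π ⟨$⟩ʳ_) (toℕ-injective (trans (toℕ-fromℕ< _) (trans e (sym (toℕ-fromℕ< _)))))

window-suc : ∀ (π : Permutation′ n) {j} (p : suc j + suc k ≤ n) (p′ : j + suc k ≤ n) →
             window π (suc k) (suc j) p ∘ inject₁ ≗ window π (suc k) j p′ ∘ suc
window-suc π {j} p p′ i = window-≡ π {p = p} {p′ = p′} (inject₁ i) (suc i) (begin
  suc j + toℕ (inject₁ i) ≡⟨ cong (suc j +_) (toℕ-inject₁ i) ⟩
  suc j + toℕ i           ≡⟨ ℕ.+-suc j (toℕ i) ⟨
  j + suc (toℕ i)         ∎)
  where open ≡-Reasoning

Ascending : (Fin (suc k) → Fin n) → Set
Ascending f = ∀ i → f (inject₁ i) < f (suc i)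

Descending : (Fin (suc k) → Fin n) → Set
Descending f = ∀ i → f (suc i) < f (inject₁ i)

ascending-≥ : {f : Fin (suc k) → Fin n} → Ascending f → ∀ i → i F.≤ f i
ascending-≥ {f = f} asc = <-weakInduction (λ i → i F.≤ f i) z≤n step
  where
  step : ∀ i → inject₁ i F.≤ f (inject₁ i) → suc i F.≤ f (suc i)
  step i i≤fi =
    ℕ.<-≤-trans (s≤s (subst (_≤ toℕ (f (inject₁ i))) (toℕ-inject₁ i) i≤fi)) (asc i)

ascending-≤ : {f : Fin (suc k) → Fin (suc k)} → Ascending f → ∀ i → f i F.≤ i
ascending-≤ {k} {f} asc = >-weakInduction (λ i → f i F.≤ i) last step
  where
  last : f (F.fromℕ k) F.≤ F.fromℕ k
  last = subst (toℕ (f (F.fromℕ k)) ≤_) (sym (toℕ-fromℕ k)) (s≤s⁻¹ (toℕ<n (f (F.fromℕ k))))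
  step : ∀ i → f (suc i) F.≤ suc i → f (inject₁ i) F.≤ inject₁ i
  step i fi≤i =
    subst (toℕ (f (inject₁ i)) ≤_) (sym (toℕ-inject₁ i)) (s≤s⁻¹ (ℕ.≤-trans (asc i) fi≤i))

ascending⇒≗id : {f : Fin (suc k) → Fin (suc k)} → Ascending f → f ≗ id
ascending⇒≗id asc i = ≤-antisym (ascending-≤ asc i) (ascending-≥ asc i)

opposite-< : {i j : Fin n} → i < j → opposite j < opposite i
opposite-< {i = i} {j} i<j =
  subst₂ Data.Nat._<_ (sym (opposite-prop j)) (sym (opposite-prop i))
    (ℕ.∸-monoʳ-< (s≤s i<j) (toℕ<n j))

descending⇒≗opposite : {f : Fin (suc k) → Fin (suc k)} → Descending f → f ≗ opposite
descending⇒≗opposite {f = f} desc i = begin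
  f i                       ≡⟨ opposite-involutive (f i) ⟨
  opposite (opposite (f i)) ≡⟨ cong opposite (ascending⇒≗id {f = opposite ∘ f} asc i) ⟩
  opposite i                ∎
  where
  open ≡-Reasoning
  asc : Ascending (opposite ∘ f)
  asc = opposite-< ∘ desc

ascent-propagates : {f : Fin (suc (suc k)) → Fin n} → OrderIso (f ∘ inject₁) (f ∘ suc) →
                    f zero < f (suc zero) → Ascending f
ascent-propagates {f = f} iso f₀<f₁ =
  <-weakInduction (λ i → f (inject₁ i) < f (suc i)) f₀<f₁
    (λ i → Equivalence.to (iso (inject₁ i) (suc i)))

descent-propagates : {f : Fin (suc (suc k)) → Fin n} → OrderIso (f ∘ inject₁) (f ∘ suc) →
                     f (suc zero) < f zero → Descending f
descent-propagates {f = f} iso f₁<f₀ =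
  <-weakInduction (λ i → f (suc i) < f (inject₁ i)) f₁<f₀
    (λ i → Equivalence.to (iso (suc i) (inject₁ i)))

ascending⊎descending : {f : Fin (suc (suc k)) → Fin n} → Injective _≡_ _≡_ f →
                       OrderIso (f ∘ inject₁) (f ∘ suc) → Ascending f ⊎ Descending f
ascending⊎descending {f = f} f-inj iso with <-cmp (f zero) (f (suc zero))
... | tri< f₀<f₁ _ _ = inj₁ (ascent-propagates {f = f} iso f₀<f₁)
... | tri≈ _ f₀≡f₁ _ = ⊥-elim (0≢1+n (f-inj f₀≡f₁))
... | tri> _ _ f₁<f₀ = inj₂ (descent-propagates {f = f} iso f₁<f₀)

lemma2p4 : (k n j : ℕ) → 2 ≤ k → suc k ≤ n → (jk : suc j + k ≤ n)
    → (π : Permutation′ n) (μ : Permutation′ k)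
    → OrderIso (window π k j (prevBound {j} {k} jk)) (μ ⟨$⟩ʳ_)
    → OrderIso (window π k (suc j) jk) (μ ⟨$⟩ʳ_)
    → Increasing μ ⊎ Decreasing μ
lemma2p4 k n j (s≤s (s≤s _)) _ jk π μ isoA isoB =
  Data.Sum.map ascending⇒≗id descending⇒≗opposite
    (ascending⊎descending (Injection.injective (↔⇒↣ μ)) shift-invariant)
  where
  shift-invariant : OrderIso ((μ ⟨$⟩ʳ_) ∘ inject₁) ((μ ⟨$⟩ʳ_) ∘ suc)
  shift-invariant =
    OrderIso-trans (OrderIso-sym (OrderIso-∘ isoB inject₁))
      (OrderIso-trans (≗⇒OrderIso (window-suc π jk (prevBound {j} {k} jk)))
        (OrderIso-∘ isoA suc))
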